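{- Let $\mathcal{M}$ be a homogeneous structure whose age has the free amalgamation property. Then for every finite $A\subset M$ and every nonalgebraic $p(x)\in S_1^{\mathcal{M}}(A)$ there is no nontrivial $A$-definable equivalence relation on $p(\mathcal{M})$.
   Context: A structure is homogeneous if it is countable, has a finite relational vocabulary $V$, and every isomorphism between finite substructures extends to an automorphism. The age of $\mathcal{M}$ is the class of finite $V$-structures embeddable in $\mathcal{M}$. The free amalgam of $V$-structures $\mathcal{A}$ and $\mathcal{B}$ is the structure $\mathcal{C}$ with universe $A\cup B$ such that for each $R\in V$, $R^{\mathcal{C}}=R^{\mathcal{A}}\cup R^{\mathcal{B}}$. A class $\mathbf{K}$ of finite $V$-structures closed under isomorphism has the free amalgamation property if for all $\mathcal{A},\mathcal{B}\in\mathbf{K}$ the free amalgam of $\mathcal{A}$ and $\mathcal{B}$ belongs to $\mathbf{K}$. An equivalence relation is nontrivial if it has at least two classes and at least one class with more than one element. $p(\mathcal{M})$ is the set of realizations of $p$ in $\mathcal{M}$. -}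

module Defs where

open import Level using (0ℓ)
open import Data.Nat using (ℕ; suc; _+_)
open import Data.Fin using (Fin; _↑ˡ_; _↑ʳ_; splitAt)
open import Data.Vec using (Vec; []; _∷_; lookup; map)
open import Data.List using (List)
open import Data.List.Membership.Propositional using (_∈_)
open import Data.List.Relation.Unary.All using (All)
open import Data.Product using (Σ; _×_; _,_)
open import Data.Sum using (_⊎_; [_,_])
open import Data.Empty using (⊥)
open import Relation.Nullary using (¬_)
open import Relation.Binary.PropositionalEquality using (_≡_; _≢_)
open import Function using (_∘_; _⇔_; _↔_; Inverse)
open import Function.Definitions using (Injective)

record Vocabulary : Set where
  field
    nRel  : ℕ
    arity : Fin nRel → ℕ

module _ (V : Vocabulary) where
  open Vocabulary V

  record Structure : Set₁ where
    field
      Carrier : Set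
      rel     : (r : Fin nRel) → Vec Carrier (arity r) → Set

  FinStr : ℕ → Set₁
  FinStr n = (r : Fin nRel) → Vec (Fin n) (arity r) → Set

  module _ (M : Structure) where
    open Structure M

    Countable : Set
    Countable = Σ (Carrier → ℕ) λ f → Injective _≡_ _≡_ f

    -- the map  a_i ↦ b_i  is an isomorphism between the finite
    -- substructures generated by a and b (well-defined, injective,
    -- preserving and reflecting all relations)
    PartialIso : ∀ {n} → Vec Carrier n → Vec Carrier n → Set
    PartialIso {n} a b =
      (∀ (i j : Fin n) → (lookup a i ≡ lookup a j) ⇔ (lookup b i ≡ lookup b j)) ×
      (∀ (r : Fin nRel) (t : Vec (Fin n) (arity r)) →
         rel r (map (lookup a) t) ⇔ rel r (map (lookup b) t))

    record Automorphism : Set where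
      field
        σ        : Carrier ↔ Carrier
        preserve : ∀ (r : Fin nRel) (t : Vec Carrier (arity r)) →
                   rel r t ⇔ rel r (map (Inverse.to σ) t)

    Homogeneous : Set
    Homogeneous =
      Countable ×
      (∀ n (a b : Vec Carrier n) → PartialIso a b →
         Σ Automorphism λ g →
           ∀ i → Inverse.to (Automorphism.σ g) (lookup a i) ≡ lookup b i)

    IsEmbedding : ∀ {n} → FinStr n → (Fin n → Carrier) → Set
    IsEmbedding {n} A f =
      Injective _≡_ _≡_ f ×
      (∀ (r : Fin nRel) (t : Vec (Fin n) (arity r)) → A r t ⇔ rel r (map f t))

    InAge : ∀ {n} → FinStr n → Set
    InAge {n} A = Σ (Fin n → Carrier) (IsEmbedding A)

  -- A lives on Fin (c + a), B on Fin (c + b); they share the first c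
  -- elements.  The free amalgam lives on Fin (c + a + b).
  inA : ∀ {c a b} → Fin (c + a) → Fin (c + a + b)
  inA {c} {a} {b} i = i ↑ˡ b

  inB : ∀ {c a b} → Fin (c + b) → Fin (c + a + b)
  inB {c} {a} {b} =
    [ (λ i → (i ↑ˡ a) ↑ˡ b) , (λ j → (c + a) ↑ʳ j) ] ∘ splitAt c

  Agree : ∀ {c a b} → FinStr (c + a) → FinStr (c + b) → Set
  Agree {c} {a} {b} A B =
    ∀ (r : Fin nRel) (t : Vec (Fin c) (arity r)) →
      A r (map (_↑ˡ a) t) ⇔ B r (map (_↑ˡ b) t)

  FreeAmalgam : ∀ {c a b} → FinStr (c + a) → FinStr (c + b) → FinStr (c + a + b)
  FreeAmalgam {c} {a} {b} A B r t =
    (Σ (Vec (Fin (c + a)) (arity r)) λ s → A r s × map (inA {c} {a} {b}) s ≡ t) ⊎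
    (Σ (Vec (Fin (c + b)) (arity r)) λ s → B r s × map (inB {c} {a} {b}) s ≡ t)

  FreeAmalgamationProperty : Structure → Set₁
  FreeAmalgamationProperty M =
    ∀ c a b (A : FinStr (c + a)) (B : FinStr (c + b)) →
      Agree {c} {a} {b} A B → InAge M A → InAge M B →
      InAge M (FreeAmalgam {c} {a} {b} A B)

  -- First-order formulas with parameters from a finite set of size m
  -- and n free variables (de Bruijn)

  data Term (m n : ℕ) : Set where
    var : Fin n → Term m n
    par : Fin m → Term m n

  data Formula (m : ℕ) : ℕ → Set where
    atom : ∀ {n} (r : Fin nRel) → Vec (Term m n) (arity r) → Formula m n
    _≐_  : ∀ {n} → Term m n → Term m n → Formula m n
    ⊥f   : ∀ {n} → Formula m n
    ¬f   : ∀ {n} → Formula m n → Formula m n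
    _∧f_ : ∀ {n} → Formula m n → Formula m n → Formula m n
    _∨f_ : ∀ {n} → Formula m n → Formula m n → Formula m n
    _⇒f_ : ∀ {n} → Formula m n → Formula m n → Formula m n
    ∃f   : ∀ {n} → Formula m (suc n) → Formula m n
    ∀f   : ∀ {n} → Formula m (suc n) → Formula m n

  module _ (M : Structure) where
    open Structure M

    evalT : ∀ {m n} → Vec Carrier m → Vec Carrier n → Term m n → Carrier
    evalT A env (var i) = lookup env i
    evalT A env (par j) = lookup A j

    Sat : ∀ {m n} → Vec Carrier m → Formula m n → Vec Carrier n → Set
    Sat A (atom r ts) env = rel r (map (evalT A env) ts)
    Sat A (s ≐ t)     env = evalT A env s ≡ evalT A env t
    Sat A ⊥f          env = ⊥
    Sat A (¬f φ)      env = ¬ Sat A φ env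
    Sat A (φ ∧f ψ)    env = Sat A φ env × Sat A ψ env
    Sat A (φ ∨f ψ)    env = Sat A φ env ⊎ Sat A ψ env
    Sat A (φ ⇒f ψ)    env = Sat A φ env → Sat A ψ env
    Sat A (∃f φ)      env = Σ Carrier λ x → Sat A φ (x ∷ env)
    Sat A (∀f φ)      env = ∀ (x : Carrier) → Sat A φ (x ∷ env)

    -- Complete 1-types over A  (p ∈ S₁^M(A)), as sets of L_A-formulas
    -- in one free variable: complete and finitely satisfiable in M.

    Type1 : ℕ → Set₁
    Type1 m = Formula m 1 → Set

    IsCompleteType : ∀ {m} → Vec Carrier m → Type1 m → Set
    IsCompleteType {m} A p =
      (∀ (φ : Formula m 1) → p φ ⊎ p (¬f φ)) ×
      (∀ (L : List (Formula m 1)) → All p L →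
         Σ Carrier λ x → All (λ φ → Sat A φ (x ∷ [])) L)

    Realizes : ∀ {m} → Vec Carrier m → Type1 m → Carrier → Set
    Realizes {m} A p x = ∀ (φ : Formula m 1) → p φ → Sat A φ (x ∷ [])

    AlgebraicFormula : ∀ {m} → Vec Carrier m → Formula m 1 → Set
    AlgebraicFormula A φ =
      Σ (List Carrier) λ L → ∀ x → Sat A φ (x ∷ []) → x ∈ L

    NonAlgebraic : ∀ {m} → Vec Carrier m → Type1 m → Set
    NonAlgebraic {m} A p =
      ∀ (φ : Formula m 1) → p φ → ¬ AlgebraicFormula A φ

    RelE : ∀ {m} → Vec Carrier m → Formula m 2 → Carrier → Carrier → Set
    RelE A E x y = Sat A E (x ∷ y ∷ [])

    IsEquivOn : ∀ {m} → Vec Carrier m → Type1 m → Formula m 2 → Set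
    IsEquivOn A p E =
      (∀ x → Realizes A p x → RelE A E x x) ×
      (∀ x y → Realizes A p x → Realizes A p y →
         RelE A E x y → RelE A E y x) ×
      (∀ x y z → Realizes A p x → Realizes A p y → Realizes A p z →
         RelE A E x y → RelE A E y z → RelE A E x z)

    NontrivialOn : ∀ {m} → Vec Carrier m → Type1 m → Formula m 2 → Set
    NontrivialOn A p E =
      (Σ Carrier λ x → Σ Carrier λ y →
         Realizes A p x × Realizes A p y × ¬ RelE A E x y) ×
      (Σ Carrier λ x → Σ Carrier λ y →
         Realizes A p x × Realizes A p y × x ≢ y × RelE A E x y)

-- Let b ≠ c realize p with b E c, and let x, y realize p with ¬ x E y. Call realizations
-- u, v unlinked if no relation holds of a tuple from A ∪ {u, v} that mentions
-- both. Since p is complete (and nonalgebraic, so its realizations avoid A), all pairs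
-- of distinct unlinked realizations have the same quantifier-free type over A, so by
-- homogeneity either all of them or none of them are E-related. Free amalgamation
-- together with homogeneity produces such pairs: a copy e₀ of c over A ∪ {b} unlinked
-- from c, which gives c E e₀ through b, and a copy e of x over A unlinked from both x
-- and y. Hence x E e and y E e, so x E y.
module Submission where

open import Defs
open import Level using (0ℓ)
open import Axiom.ExcludedMiddle using (ExcludedMiddle)
open import Data.Nat as ℕ using (ℕ; zero; suc; _+_)
open import Data.Fin using (Fin; zero; suc; _↑ˡ_; _↑ʳ_; splitAt) renaming (_≟_ to _≟ᶠ_)
open import Data.Fin.Properties using (splitAt-↑ˡ; splitAt-↑ʳ; ↑ˡ-injective; ↑ʳ-injective; any?)
open import Data.Vec using (Vec; []; _∷_; lookup; map; head; tail; tabulate)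
open import Data.Vec.Properties using (map-cong; map-∘; map-id; lookup-map; lookup∘tabulate)
open import Data.Vec.Functional using (_++_; replicate)
open import Data.Vec.Functional.Properties using (lookup-++ˡ; lookup-++ʳ)
open import Data.Vec.Membership.Propositional using (_∈_; _∉_)
open import Data.Vec.Relation.Unary.Any using (here; there; satisfied)
open import Data.Vec.Relation.Unary.Any.Properties using (map⁻)
open import Data.Vec.Membership.Propositional.Properties using (∈-map⁺)
import Data.List as List
import Data.List.Relation.Unary.Any as Listₐ
open import Data.Product using (Σ; ∃; _×_; _,_; proj₁; proj₂)
open import Data.Sum using (inj₁; inj₂; [_,_])
open import Function using (_∘_; id; _⇔_; mk⇔; Equivalence; Inverse)
open import Function.Construct.Symmetry using (⇔-sym; ↔-sym)
open import Function.Construct.Composition using (_⇔-∘_)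
open import Function.Definitions using (Injective)
open import Relation.Binary.PropositionalEquality hiding ([_])
open import Relation.Nullary using (¬_; yes; no; contradiction)
open import Relation.Nullary.Decidable using (map′)
open import Relation.Binary.Definitions using (DecidableEquality)

private variable
  X : Set
  k m n : ℕ

↑ˡ≢↑ʳ : (i : Fin m) (j : Fin n) → i ↑ˡ n ≢ m ↑ʳ j
↑ˡ≢↑ʳ {m} {n} i j eq
  with trans (sym (splitAt-↑ˡ m i n)) (trans (cong (splitAt m) eq) (splitAt-↑ʳ m n j))
... | ()

data SplitView (m n : ℕ) : Fin (m + n) → Set where
  left  : (i : Fin m) → SplitView m n (i ↑ˡ n)
  right : (j : Fin n) → SplitView m n (m ↑ʳ j)

splitView : ∀ m {n} (i : Fin (m + n)) → SplitView m n i
splitView zero    i       = right i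
splitView (suc m) zero    = left zero
splitView (suc m) (suc i) with splitView m i
... | left j  = left (suc j)
... | right j = right j

++-injective : {xs : Fin m → X} {ys : Fin n → X} →
               Injective _≡_ _≡_ xs → Injective _≡_ _≡_ ys → (∀ i j → xs i ≢ ys j) →
               Injective _≡_ _≡_ (xs ++ ys)
++-injective {m = m} {n = n} {xs} {ys} xs-inj ys-inj disjoint {i} {j} eq
  with splitView m i | splitView m j
... | left i′  | left j′  =
  cong (_↑ˡ n) (xs-inj (trans (sym (lookup-++ˡ xs ys i′)) (trans eq (lookup-++ˡ xs ys j′))))
... | left i′  | right j′ =
  contradiction (trans (sym (lookup-++ˡ xs ys i′)) (trans eq (lookup-++ʳ xs ys j′))) (disjoint i′ j′)
... | right i′ | left j′  =
  contradiction (trans (sym (lookup-++ˡ xs ys j′)) (trans (sym eq) (lookup-++ʳ xs ys i′))) (disjoint j′ i′)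
... | right i′ | right j′ =
  cong (m ↑ʳ_) (ys-inj (trans (sym (lookup-++ʳ xs ys i′)) (trans eq (lookup-++ʳ xs ys j′))))

replicate₁-injective : {z : X} → Injective _≡_ _≡_ (replicate 1 z)
replicate₁-injective {x = zero} {y = zero} _ = refl

++-≢ : {xs : Fin m → X} {ys : Fin n → X} {z : X} →
       (∀ i → xs i ≢ z) → (∀ j → ys j ≢ z) → ∀ i → (xs ++ ys) i ≢ z
++-≢ {m = m} {xs = xs} {ys} xs≢z ys≢z i eq with splitView m i
... | left i′  = xs≢z i′ (trans (sym (lookup-++ˡ xs ys i′)) eq)
... | right j′ = ys≢z j′ (trans (sym (lookup-++ʳ xs ys j′)) eq)

++-≗ : {xs : Fin m → X} {ys : Fin n → X} {f : Fin (m + n) → X} →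
       (∀ i → xs i ≡ f (i ↑ˡ n)) → (∀ j → ys j ≡ f (m ↑ʳ j)) → ∀ i → (xs ++ ys) i ≡ f i
++-≗ {m = m} {xs = xs} {ys} xs≗f ys≗f i with splitView m i
... | left i′  = trans (lookup-++ˡ xs ys i′) (xs≗f i′)
... | right j′ = trans (lookup-++ʳ xs ys j′) (ys≗f j′)

map-++-↑ˡ : {xs : Fin m → X} (ys : Fin n → X) (t : Vec (Fin m) k) → map (xs ++ ys) (map (_↑ˡ n) t) ≡ map xs t
map-++-↑ˡ {xs = xs} ys t = trans (sym (map-∘ _ _ t)) (map-cong (lookup-++ˡ xs ys) t)

map-injective : {B : Set} {f : X → B} → Injective _≡_ _≡_ f → Injective _≡_ _≡_ (map {n = n} f)
map-injective f-inj {[]}    {[]}    eq = refl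
map-injective f-inj {x ∷ s} {y ∷ t} eq = cong₂ _∷_ (f-inj (cong head eq)) (map-injective f-inj (cong tail eq))

map-cong-∉ : {B : Set} {f g : Fin n → B} (i : Fin n) → (∀ j → i ≢ j → f j ≡ g j) →
             (s : Vec (Fin n) k) → i ∉ s → map f s ≡ map g s
map-cong-∉ i f≗g []      i∉s = refl
map-cong-∉ i f≗g (j ∷ s) i∉s = cong₂ _∷_ (f≗g j (i∉s ∘ here)) (map-cong-∉ i f≗g s (i∉s ∘ there))

∈-map⁻ : {B : Set} (f : X → B) {y : B} (s : Vec X n) → y ∈ map f s → ∃ λ x → y ≡ f x
∈-map⁻ f s y∈ = satisfied (map⁻ y∈)

module _ (V : Vocabulary) where
  open Vocabulary V

  FinEmbedding : ∀ {n N} → FinStr V n → FinStr V N → (Fin n → Fin N) → Set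
  FinEmbedding S T h = Injective _≡_ _≡_ h × (∀ r t → S r t ⇔ T r (map h t))

  module _ {c a b : ℕ} (S : FinStr V (c + a)) (T : FinStr V (c + b)) where
    private
      ιA : Fin (c + a) → Fin (c + a + b)
      ιA = inA V {c} {a} {b}
      ιB : Fin (c + b) → Fin (c + a + b)
      ιB = inB V {c} {a} {b}

    inB-↑ˡ : (i : Fin c) → ιB (i ↑ˡ b) ≡ ιA (i ↑ˡ a)
    inB-↑ˡ i = cong [ (λ i → (i ↑ˡ a) ↑ˡ b) , (c + a) ↑ʳ_ ] (splitAt-↑ˡ c i b)

    inB-↑ʳ : (j : Fin b) → ιB (c ↑ʳ j) ≡ (c + a) ↑ʳ j
    inB-↑ʳ j = cong [ (λ i → (i ↑ˡ a) ↑ˡ b) , (c + a) ↑ʳ_ ] (splitAt-↑ʳ c b j)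

    inA-injective : Injective _≡_ _≡_ ιA
    inA-injective = ↑ˡ-injective b _ _

    inB-injective : Injective _≡_ _≡_ ιB
    inB-injective {x} {y} eq with splitView c x | splitView c y
    ... | left i  | left j  =
      cong (_↑ˡ b) (↑ˡ-injective a i j (inA-injective (trans (sym (inB-↑ˡ i)) (trans eq (inB-↑ˡ j)))))
    ... | left i  | right j = contradiction (trans (sym (inB-↑ˡ i)) (trans eq (inB-↑ʳ j))) (↑ˡ≢↑ʳ _ j)
    ... | right i | left j  = contradiction (trans (sym (inB-↑ˡ j)) (trans (sym eq) (inB-↑ʳ i))) (↑ˡ≢↑ʳ _ i)
    ... | right i | right j =
      cong (c ↑ʳ_) (↑ʳ-injective (c + a) i j (trans (sym (inB-↑ʳ i)) (trans eq (inB-↑ʳ j))))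

    inB≡inA⇒common : ∀ {x y} → ιB x ≡ ιA y → ∃ λ i → x ≡ i ↑ˡ b × y ≡ i ↑ˡ a
    inB≡inA⇒common {x} {y} eq with splitView c x
    ... | left i  = i , refl , inA-injective (trans (sym eq) (inB-↑ˡ i))
    ... | right j = contradiction (trans (sym eq) (inB-↑ʳ j)) (↑ˡ≢↑ʳ y j)

    map-inB≡map-inA⇒common : ∀ {n} (s : Vec (Fin (c + b)) n) (t : Vec (Fin (c + a)) n) → map ιB s ≡ map ιA t →
                             ∃ λ u → s ≡ map (_↑ˡ b) u × t ≡ map (_↑ˡ a) u
    map-inB≡map-inA⇒common []      []      eq = [] , refl , refl
    map-inB≡map-inA⇒common (x ∷ s) (y ∷ t) eq
      with inB≡inA⇒common (cong head eq) | map-inB≡map-inA⇒common s t (cong tail eq)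
    ... | i , refl , refl | u , refl , refl = i ∷ u , refl , refl

    inA-embedding : Agree V {c} {a} {b} S T → FinEmbedding S (FreeAmalgam V {c} {a} {b} S T) ιA
    inA-embedding agree = inA-injective , λ r t → mk⇔ (λ St → inj₁ (t , St , refl)) (from r t)
      where
      from : ∀ r t → FreeAmalgam V {c} {a} {b} S T r (map ιA t) → S r t
      from r t (inj₁ (s , Ss , eq)) = subst (S r) (map-injective inA-injective eq) Ss
      from r t (inj₂ (s , Ts , eq)) with map-inB≡map-inA⇒common s t eq
      ... | u , refl , refl = Equivalence.from (agree r u) Ts

    inB-embedding : Agree V {c} {a} {b} S T → FinEmbedding T (FreeAmalgam V {c} {a} {b} S T) ιB
    inB-embedding agree = inB-injective , λ r t → mk⇔ (λ Tt → inj₂ (t , Tt , refl)) (from r t)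
      where
      from : ∀ r t → FreeAmalgam V {c} {a} {b} S T r (map ιB t) → T r t
      from r t (inj₁ (s , Ss , eq)) with map-inB≡map-inA⇒common t s (sym eq)
      ... | u , refl , refl = Equivalence.to (agree r u) Ss
      from r t (inj₂ (s , Ts , eq)) = subst (T r) (map-injective inB-injective eq) Ts

    FreeAmalgam-unmixed : ∀ r t (i : Fin a) (j : Fin b) → (c ↑ʳ i) ↑ˡ b ∈ t → (c + a) ↑ʳ j ∈ t →
                          ¬ FreeAmalgam V {c} {a} {b} S T r t
    FreeAmalgam-unmixed r t i j i∈t j∈t (inj₁ (s , _ , refl)) with ∈-map⁻ ιA s j∈t
    ... | x , eq = ↑ˡ≢↑ʳ x j (sym eq)
    FreeAmalgam-unmixed r t i j i∈t j∈t (inj₂ (s , _ , refl)) with ∈-map⁻ ιB s i∈t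
    ... | x , eq with inB≡inA⇒common (sym eq)
    ...   | k , _ , eq′ = ↑ˡ≢↑ʳ k i (sym eq′)

module Automorphisms (V : Vocabulary) (M : Structure V) where
  open Vocabulary V
  open Structure M renaming (Carrier to C)

  PartialIsoᶠ : (Fin n → C) → (Fin n → C) → Set
  PartialIsoᶠ f g = (∀ i j → (f i ≡ f j) ⇔ (g i ≡ g j)) ×
                    (∀ r t → rel r (map f t) ⇔ rel r (map g t))

  Induced : (Fin n → C) → FinStr V n
  Induced f r t = rel r (map f t)

  induced-embedding : {f : Fin n → C} → Injective _≡_ _≡_ f → IsEmbedding V M (Induced f) f
  induced-embedding f-inj = f-inj , λ r t → mk⇔ id id

  ∘-embedding : ∀ {N} {S : FinStr V n} {T : FinStr V N} {h : Fin n → Fin N} {f : Fin N → C} →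
                FinEmbedding V S T h → IsEmbedding V M T f → IsEmbedding V M S (f ∘ h)
  ∘-embedding {h = h} {f} (h-inj , S⇔T) (f-inj , T⇔M) =
    h-inj ∘ f-inj ,
    λ r t → subst (λ u → _ ⇔ rel r u) (sym (map-∘ f h t)) (T⇔M r (map h t) ⇔-∘ S⇔T r t)

  embeddings-partialIso : {S : FinStr V n} {f g : Fin n → C} →
                          IsEmbedding V M S f → IsEmbedding V M S g → PartialIsoᶠ f g
  embeddings-partialIso (f-inj , S⇔f) (g-inj , S⇔g) =
    (λ i j → mk⇔ (cong _ ∘ f-inj) (cong _ ∘ g-inj)) ,
    (λ r t → S⇔g r t ⇔-∘ ⇔-sym (S⇔f r t))

  Aut : Set
  Aut = Automorphism V M

  ⟦_⟧ : Aut → C → C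
  ⟦ g ⟧ = Inverse.to (Automorphism.σ g)

  ⟦⟧-preserves : (g : Aut) → ∀ r t → rel r t ⇔ rel r (map ⟦ g ⟧ t)
  ⟦⟧-preserves = Automorphism.preserve

  _⁻¹ : Aut → Aut
  g ⁻¹ = record
    { σ        = ↔-sym (Automorphism.σ g)
    ; preserve = λ r t →
        ⇔-sym (subst (λ u → rel r (map from t) ⇔ rel r u) (map-cancel t) (⟦⟧-preserves g r (map from t)))
    }
    where
    from = Inverse.from (Automorphism.σ g)
    map-cancel : ∀ {n} (t : Vec C n) → map ⟦ g ⟧ (map from t) ≡ t
    map-cancel t =
      trans (sym (map-∘ _ _ t)) (trans (map-cong (Inverse.strictlyInverseˡ (Automorphism.σ g)) t) (map-id t))

  ⟦⟧∘⟦⁻¹⟧ : (g : Aut) → ∀ x → ⟦ g ⟧ (⟦ g ⁻¹ ⟧ x) ≡ x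
  ⟦⟧∘⟦⁻¹⟧ g = Inverse.strictlyInverseˡ (Automorphism.σ g)

  ⟦⁻¹⟧∘⟦⟧ : (g : Aut) → ∀ x → ⟦ g ⁻¹ ⟧ (⟦ g ⟧ x) ≡ x
  ⟦⁻¹⟧∘⟦⟧ g = Inverse.strictlyInverseʳ (Automorphism.σ g)

  ⟦⟧-injective : (g : Aut) → Injective _≡_ _≡_ ⟦ g ⟧
  ⟦⟧-injective g {x} {y} eq = trans (sym (⟦⁻¹⟧∘⟦⟧ g x)) (trans (cong ⟦ g ⁻¹ ⟧ eq) (⟦⁻¹⟧∘⟦⟧ g y))

  ⟦⟧-embedding : (g : Aut) {S : FinStr V n} {f : Fin n → C} →
                 IsEmbedding V M S f → IsEmbedding V M S (⟦ g ⟧ ∘ f)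
  ⟦⟧-embedding g {f = f} (f-inj , S⇔f) =
    f-inj ∘ ⟦⟧-injective g ,
    λ r t → subst (λ u → _ ⇔ rel r u) (sym (map-∘ ⟦ g ⟧ f t)) (⟦⟧-preserves g r (map f t) ⇔-∘ S⇔f r t)

  homogeneous-extension : Homogeneous V M → {f g : Fin n → C} → PartialIsoᶠ f g →
                          Σ Aut λ σ → ∀ i → ⟦ σ ⟧ (f i) ≡ g i
  homogeneous-extension (_ , extend) {f} {g} (f≡⇔g≡ , f⇔g)
    with extend _ (tabulate f) (tabulate g) (partialIso-tabulate)
    where
    partialIso-tabulate : PartialIso V M (tabulate f) (tabulate g)
    partialIso-tabulate =
      (λ i j → subst₂ (λ x y → (x ≡ y) ⇔ _) (sym (lookup∘tabulate f i)) (sym (lookup∘tabulate f j))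
                 (subst₂ (λ x y → _ ⇔ (x ≡ y)) (sym (lookup∘tabulate g i)) (sym (lookup∘tabulate g j))
                   (f≡⇔g≡ i j))) ,
      (λ r t → subst₂ (λ u v → rel r u ⇔ rel r v)
                 (sym (map-cong (lookup∘tabulate f) t)) (sym (map-cong (lookup∘tabulate g) t)) (f⇔g r t))
  ... | σ , σ-maps =
    σ , λ i → trans (cong ⟦ σ ⟧ (sym (lookup∘tabulate f i))) (trans (σ-maps i) (lookup∘tabulate g i))

  Fixes : Aut → Vec C m → Set
  Fixes g A = ∀ j → ⟦ g ⟧ (lookup A j) ≡ lookup A j

  module _ {m} (A : Vec C m) where
    Fixes-⁻¹ : (g : Aut) → Fixes g A → Fixes (g ⁻¹) A
    Fixes-⁻¹ g g-fixes j = trans (cong ⟦ g ⁻¹ ⟧ (sym (g-fixes j))) (⟦⁻¹⟧∘⟦⟧ g (lookup A j))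

    evalT-⟦⟧ : (g : Aut) → Fixes g A → (env : Vec C n) (t : Term V m n) →
               ⟦ g ⟧ (evalT V M A env t) ≡ evalT V M A (map ⟦ g ⟧ env) t
    evalT-⟦⟧ g g-fixes env (var i) = sym (lookup-map i ⟦ g ⟧ env)
    evalT-⟦⟧ g g-fixes env (par j) = g-fixes j

    Sat-⟦⟧⁻ : (g : Aut) → Fixes g A → (φ : Formula V m n) (env : Vec C n) →
              Sat V M A φ (map ⟦ g ⟧ env) → Sat V M A φ env

    Sat-⟦⟧ : (g : Aut) → Fixes g A → (φ : Formula V m n) (env : Vec C n) →
             Sat V M A φ env → Sat V M A φ (map ⟦ g ⟧ env)
    Sat-⟦⟧ g g-fixes (atom r ts) env sat =
      subst (rel r) (trans (sym (map-∘ _ _ ts)) (map-cong (evalT-⟦⟧ g g-fixes env) ts))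
        (Equivalence.to (⟦⟧-preserves g r _) sat)
    Sat-⟦⟧ g g-fixes (s ≐ t) env sat =
      trans (sym (evalT-⟦⟧ g g-fixes env s)) (trans (cong ⟦ g ⟧ sat) (evalT-⟦⟧ g g-fixes env t))
    Sat-⟦⟧ g g-fixes (¬f φ) env ¬sat = ¬sat ∘ Sat-⟦⟧⁻ g g-fixes φ env
    Sat-⟦⟧ g g-fixes (φ ∧f ψ) env (sat₁ , sat₂) =
      Sat-⟦⟧ g g-fixes φ env sat₁ , Sat-⟦⟧ g g-fixes ψ env sat₂
    Sat-⟦⟧ g g-fixes (φ ∨f ψ) env (inj₁ sat) = inj₁ (Sat-⟦⟧ g g-fixes φ env sat)
    Sat-⟦⟧ g g-fixes (φ ∨f ψ) env (inj₂ sat) = inj₂ (Sat-⟦⟧ g g-fixes ψ env sat)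
    Sat-⟦⟧ g g-fixes (φ ⇒f ψ) env sat = Sat-⟦⟧ g g-fixes ψ env ∘ sat ∘ Sat-⟦⟧⁻ g g-fixes φ env
    Sat-⟦⟧ g g-fixes (∃f φ) env (x , sat) = ⟦ g ⟧ x , Sat-⟦⟧ g g-fixes φ (x ∷ env) sat
    Sat-⟦⟧ g g-fixes (∀f φ) env sat y =
      subst (λ x → Sat V M A φ (x ∷ map ⟦ g ⟧ env)) (⟦⟧∘⟦⁻¹⟧ g y)
        (Sat-⟦⟧ g g-fixes φ (⟦ g ⁻¹ ⟧ y ∷ env) (sat (⟦ g ⁻¹ ⟧ y)))

    -- Terminates since each call from Sat-⟦⟧ is on a proper subformula.
    Sat-⟦⟧⁻ g g-fixes φ env sat =
      subst (Sat V M A φ) (trans (sym (map-∘ _ _ env)) (trans (map-cong (⟦⁻¹⟧∘⟦⟧ g) env) (map-id env)))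
        (Sat-⟦⟧ (g ⁻¹) (Fixes-⁻¹ g g-fixes) φ (map ⟦ g ⟧ env) sat)

module FreeExtension (V : Vocabulary) (M : Structure V) where
  open Vocabulary V
  open Structure M renaming (Carrier to C)
  open Automorphisms V M

  Unlinked : ∀ {N} → (Fin N → C) → Fin N → Fin N → Set
  Unlinked val i j = ∀ r (s : Vec _ (arity r)) → i ∈ s → j ∈ s → ¬ rel r (map val s)

  record FreeCopy {k a} (w : Fin k → C) (u : Fin a → C) (z : C) : Set where
    field
      τ             : Aut
      τ-fixes       : ∀ i → ⟦ τ ⟧ (w i) ≡ w i
      copy-fresh    : ∀ i → (w ++ u) i ≢ ⟦ τ ⟧ z
      copy-unlinked : ∀ i → Unlinked ((w ++ u) ++ replicate 1 (⟦ τ ⟧ z)) ((k ↑ʳ i) ↑ˡ 1) ((k + a) ↑ʳ zero)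

  free-extension : Homogeneous V M → FreeAmalgamationProperty V M →
                   ∀ {k a} (w : Fin k → C) (u : Fin a → C) (z : C) →
                   Injective _≡_ _≡_ (w ++ u) → Injective _≡_ _≡_ (w ++ replicate 1 z) → FreeCopy w u z
  free-extension hom fap {k} {a} w u z wu-inj wz-inj = record
    { τ             = τ
    ; τ-fixes       = τ-fixes
    ; copy-fresh    = λ i eq → ↑ˡ≢↑ʳ i zero (f-inj (trans (f∘inA i) (trans eq τz≡f-copy)))
    ; copy-unlinked = λ i r s i∈s copy∈s sat →
        FreeAmalgam-unmixed V S T r s i zero i∈s copy∈s
          (Equivalence.from (f-rel r s) (subst (rel r) (map-cong val≗f s) sat))
    }
    where
    wu : Fin (k + a) → C
    wu = w ++ u
    wz : Fin (k + 1) → C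
    wz = w ++ replicate 1 z
    S : FinStr V (k + a)
    S = Induced wu
    T : FinStr V (k + 1)
    T = Induced wz
    ιA : Fin (k + a) → Fin (k + a + 1)
    ιA = inA V {k} {a} {1}
    ιB : Fin (k + 1) → Fin (k + a + 1)
    ιB = inB V {k} {a} {1}

    agree : Agree V {k} {a} {1} S T
    agree r t = subst₂ (λ x y → rel r x ⇔ rel r y)
                  (sym (map-++-↑ˡ u t)) (sym (map-++-↑ˡ (replicate 1 z) t)) (mk⇔ id id)

    amalgam : InAge V M (FreeAmalgam V {k} {a} {1} S T)
    amalgam = fap k a 1 S T agree (wu , induced-embedding wu-inj) (wz , induced-embedding wz-inj)
    f₀ : Fin (k + a + 1) → C
    f₀ = proj₁ amalgam

    σ : Σ Aut λ σ → ∀ i → ⟦ σ ⟧ (wu i) ≡ f₀ (ιA i)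
    σ = homogeneous-extension hom
          (embeddings-partialIso (induced-embedding wu-inj) (∘-embedding (inA-embedding V S T agree) (proj₂ amalgam)))

    -- Moving the amalgam back by σ ⁻¹ makes its A-part the original tuple wu.
    f : Fin (k + a + 1) → C
    f = ⟦ proj₁ σ ⁻¹ ⟧ ∘ f₀
    f-emb : IsEmbedding V M (FreeAmalgam V {k} {a} {1} S T) f
    f-emb = ⟦⟧-embedding (proj₁ σ ⁻¹) (proj₂ amalgam)
    f-inj : Injective _≡_ _≡_ f
    f-inj = proj₁ f-emb
    f-rel : ∀ r t → FreeAmalgam V {k} {a} {1} S T r t ⇔ rel r (map f t)
    f-rel = proj₂ f-emb

    f∘inA : ∀ i → f (ιA i) ≡ wu i
    f∘inA i = trans (cong ⟦ proj₁ σ ⁻¹ ⟧ (sym (proj₂ σ i))) (⟦⁻¹⟧∘⟦⟧ (proj₁ σ) (wu i))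

    τ-ext : Σ Aut λ τ → ∀ i → ⟦ τ ⟧ (wz i) ≡ f (ιB i)
    τ-ext = homogeneous-extension hom
              (embeddings-partialIso (induced-embedding wz-inj) (∘-embedding (inB-embedding V S T agree) f-emb))
    τ : Aut
    τ = proj₁ τ-ext

    τ-maps : ∀ i → ⟦ τ ⟧ (wz i) ≡ f (ιB i)
    τ-maps = proj₂ τ-ext

    τ-fixes : ∀ i → ⟦ τ ⟧ (w i) ≡ w i
    τ-fixes i = begin
      ⟦ τ ⟧ (w i)           ≡⟨ cong ⟦ τ ⟧ (lookup-++ˡ w _ i) ⟨
      ⟦ τ ⟧ (wz (i ↑ˡ 1))   ≡⟨ τ-maps (i ↑ˡ 1) ⟩
      f (ιB (i ↑ˡ 1))       ≡⟨ cong f (inB-↑ˡ V S T i) ⟩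
      f (ιA (i ↑ˡ a))       ≡⟨ f∘inA (i ↑ˡ a) ⟩
      wu (i ↑ˡ a)           ≡⟨ lookup-++ˡ w u i ⟩
      w i                   ∎
      where open ≡-Reasoning

    τz≡f-copy : ⟦ τ ⟧ z ≡ f ((k + a) ↑ʳ zero)
    τz≡f-copy = begin
      ⟦ τ ⟧ z               ≡⟨ cong ⟦ τ ⟧ (lookup-++ʳ w _ zero) ⟨
      ⟦ τ ⟧ (wz (k ↑ʳ zero)) ≡⟨ τ-maps (k ↑ʳ zero) ⟩
      f (ιB (k ↑ʳ zero))     ≡⟨ cong f (inB-↑ʳ V S T zero) ⟩
      f ((k + a) ↑ʳ zero)    ∎
      where open ≡-Reasoning

    val≗f : ∀ x → (wu ++ replicate 1 (⟦ τ ⟧ z)) x ≡ f x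
    val≗f = ++-≗ (sym ∘ f∘inA) λ { zero → τz≡f-copy }

  Unlinked-reindex : ∀ {N} {val : Fin N → C} {val′ : Fin n → C} (h : Fin n → Fin N) →
                     (∀ i → val (h i) ≡ val′ i) → ∀ {i j} → Unlinked val (h i) (h j) → Unlinked val′ i j
  Unlinked-reindex {val = val} h h-agrees unlinked r s i∈s j∈s sat =
    unlinked r (map h s) (∈-map⁺ h i∈s) (∈-map⁺ h j∈s)
      (subst (rel r) (trans (sym (map-cong h-agrees s)) (map-∘ val h s)) sat)

module _ (V : Vocabulary) (M : Structure V) where
  open Vocabulary V
  open Structure M renaming (Carrier to C)

  Countable⇒≡-dec : Countable V M → DecidableEquality C
  Countable⇒≡-dec (code , code-inj) x y = map′ code-inj (cong code) (code x ℕ.≟ code y)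

  record InjectiveCover (B : Vec C k) : Set where
    field
      size       : ℕ
      enum       : Fin size → C
      enum-inj   : Injective _≡_ _≡_ enum
      index      : Fin k → Fin size
      enum-index : ∀ j → enum (index j) ≡ lookup B j
      enum-in    : ∀ q → ∃ λ j → lookup B j ≡ enum q

  injectiveCover : DecidableEquality C → (B : Vec C k) → InjectiveCover B
  injectiveCover _≟_ [] = record
    { size = 0 ; enum = λ () ; enum-inj = λ { {()} } ; index = λ () ; enum-index = λ () ; enum-in = λ () }
  injectiveCover _≟_ (x ∷ B) with injectiveCover _≟_ B
  ... | cover with any? (λ q → x ≟ InjectiveCover.enum cover q)
  ...   | yes (q , x≡) = record
    { size       = size
    ; enum       = enum
    ; enum-inj   = enum-inj
    ; index      = λ { zero → q ; (suc j) → index j }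
    ; enum-index = λ { zero → sym x≡ ; (suc j) → enum-index j }
    ; enum-in    = λ q′ → suc (proj₁ (enum-in q′)) , proj₂ (enum-in q′)
    }
    where open InjectiveCover cover
  ...   | no x∉ = record
    { size       = suc size
    ; enum       = enum′
    ; enum-inj   = enum′-inj
    ; index      = λ { zero → zero ; (suc j) → suc (index j) }
    ; enum-index = λ { zero → refl ; (suc j) → enum-index j }
    ; enum-in    = λ { zero → zero , refl ; (suc q) → suc (proj₁ (enum-in q)) , proj₂ (enum-in q) }
    }
    where
    open InjectiveCover cover
    enum′ : Fin (suc size) → C
    enum′ zero    = x
    enum′ (suc q) = enum q
    enum′-inj : Injective _≡_ _≡_ enum′
    enum′-inj {zero}  {zero}   _  = refl
    enum′-inj {zero}  {suc q}  eq = contradiction (q , eq) x∉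
    enum′-inj {suc q} {zero}   eq = contradiction (q , sym eq) x∉
    enum′-inj {suc q} {suc q′} eq = cong suc (enum-inj eq)

module Realizations (V : Vocabulary) (M : Structure V) {m} (A : Vec (Structure.Carrier M) m) (p : Type1 V M m)
                (p-complete : IsCompleteType V M A p) (p-nonalgebraic : NonAlgebraic V M A p) where
  open Vocabulary V
  open Structure M renaming (Carrier to C)
  open Automorphisms V M
  open FreeExtension V M
  open import Data.Vec.Membership.DecPropositional (_≟ᶠ_ {2 + m}) using (_∈?_)

  _∈p : C → Set
  x ∈p = Realizes V M A p x

  realization-∉-params : ∀ {x} → x ∈p → ∀ j → x ≢ lookup A j
  realization-∉-params x∈p j x≡aⱼ with proj₁ p-complete (var zero ≐ par j)
  ... | inj₁ p∋x≐aⱼ = p-nonalgebraic _ p∋x≐aⱼ (List.[ lookup A j ] , λ y y≡aⱼ → Listₐ.here y≡aⱼ)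
  ... | inj₂ p∋x≢aⱼ = x∈p _ p∋x≢aⱼ x≡aⱼ

  realizations-agree : ∀ {x y} → x ∈p → y ∈p → (φ : Formula V m 1) →
                       Sat V M A φ (x ∷ []) → Sat V M A φ (y ∷ [])
  realizations-agree x∈p y∈p φ sat with proj₁ p-complete φ
  ... | inj₁ p∋φ  = y∈p φ p∋φ
  ... | inj₂ p∋¬φ = contradiction sat (x∈p _ p∋¬φ)

  ⟪_,_⟫ : C → C → Fin (2 + m) → C
  ⟪ u , v ⟫ zero          = u
  ⟪ u , v ⟫ (suc zero)    = v
  ⟪ u , v ⟫ (suc (suc j)) = lookup A j

  -- On a tuple avoiding one of the first two positions, collapse turns an atom about
  -- the pair into a formula about the remaining element.
  collapse : Fin (2 + m) → Term V m 1
  collapse zero          = var zero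
  collapse (suc zero)    = var zero
  collapse (suc (suc j)) = par j

  ⟪x,x⟫≡eval : ∀ x (s : Vec (Fin (2 + m)) k) →
               map ⟪ x , x ⟫ s ≡ map (evalT V M A (x ∷ [])) (map collapse s)
  ⟪x,x⟫≡eval x s = trans (map-cong eval-collapse s) (map-∘ _ collapse s)
    where
    eval-collapse : ∀ i → ⟪ x , x ⟫ i ≡ evalT V M A (x ∷ []) (collapse i)
    eval-collapse zero          = refl
    eval-collapse (suc zero)    = refl
    eval-collapse (suc (suc j)) = refl

  diagonal-rel-transfer : ∀ {x y} → x ∈p → y ∈p →
                          ∀ r s → rel r (map ⟪ x , x ⟫ s) → rel r (map ⟪ y , y ⟫ s)
  diagonal-rel-transfer {x} {y} x∈p y∈p r s sat =
    subst (rel r) (sym (⟪x,x⟫≡eval y s))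
      (realizations-agree x∈p y∈p (atom r (map collapse s)) (subst (rel r) (⟪x,x⟫≡eval x s) sat))

  ⟪⟫-without-first : ∀ u v (s : Vec (Fin (2 + m)) k) → zero ∉ s →
                     map ⟪ u , v ⟫ s ≡ map ⟪ v , v ⟫ s
  ⟪⟫-without-first u v = map-cong-∉ zero agree
    where
    agree : ∀ i → zero ≢ i → ⟪ u , v ⟫ i ≡ ⟪ v , v ⟫ i
    agree zero          0≢0 = contradiction refl 0≢0
    agree (suc zero)    _   = refl
    agree (suc (suc j)) _   = refl

  ⟪⟫-without-second : ∀ u v (s : Vec (Fin (2 + m)) k) → suc zero ∉ s →
                      map ⟪ u , v ⟫ s ≡ map ⟪ u , u ⟫ s
  ⟪⟫-without-second u v = map-cong-∉ (suc zero) agree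
    where
    agree : ∀ i → suc zero ≢ i → ⟪ u , v ⟫ i ≡ ⟪ u , u ⟫ i
    agree zero          _   = refl
    agree (suc zero)    1≢1 = contradiction refl 1≢1
    agree (suc (suc j)) _   = refl

  FreePair : C → C → Set
  FreePair u v = Unlinked ⟪ u , v ⟫ zero (suc zero)

  free-pair-rel : ∀ {u v u′ v′} → u ∈p → v ∈p → u′ ∈p → v′ ∈p → FreePair u v →
                  ∀ r s → rel r (map ⟪ u , v ⟫ s) → rel r (map ⟪ u′ , v′ ⟫ s)
  free-pair-rel {u} {v} {u′} {v′} u∈p v∈p u′∈p v′∈p free r s sat with zero ∈? s | suc zero ∈? s
  ... | yes 0∈s | yes 1∈s = contradiction sat (free r s 0∈s 1∈s)
  ... | no 0∉s  | _       =
    subst (rel r) (sym (⟪⟫-without-first u′ v′ s 0∉s))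
      (diagonal-rel-transfer v∈p v′∈p r s (subst (rel r) (⟪⟫-without-first u v s 0∉s) sat))
  ... | yes _   | no 1∉s  =
    subst (rel r) (sym (⟪⟫-without-second u′ v′ s 1∉s))
      (diagonal-rel-transfer u∈p u′∈p r s (subst (rel r) (⟪⟫-without-second u v s 1∉s) sat))

  distinct-pair-≡ : ∀ {u v u′ v′} → u ∈p → v ∈p → u ≢ v →
                    ∀ i j → ⟪ u , v ⟫ i ≡ ⟪ u , v ⟫ j → ⟪ u′ , v′ ⟫ i ≡ ⟪ u′ , v′ ⟫ j
  distinct-pair-≡ u∈p v∈p u≢v zero          zero          _  = refl
  distinct-pair-≡ u∈p v∈p u≢v zero          (suc zero)    eq = contradiction eq u≢v
  distinct-pair-≡ u∈p v∈p u≢v zero          (suc (suc j)) eq = contradiction eq (realization-∉-params u∈p j)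
  distinct-pair-≡ u∈p v∈p u≢v (suc zero)    zero          eq = contradiction (sym eq) u≢v
  distinct-pair-≡ u∈p v∈p u≢v (suc zero)    (suc zero)    _  = refl
  distinct-pair-≡ u∈p v∈p u≢v (suc zero)    (suc (suc j)) eq = contradiction eq (realization-∉-params v∈p j)
  distinct-pair-≡ u∈p v∈p u≢v (suc (suc i)) zero          eq = contradiction (sym eq) (realization-∉-params u∈p i)
  distinct-pair-≡ u∈p v∈p u≢v (suc (suc i)) (suc zero)    eq = contradiction (sym eq) (realization-∉-params v∈p i)
  distinct-pair-≡ u∈p v∈p u≢v (suc (suc i)) (suc (suc j)) eq = eq

  free-pairs-partialIso : ∀ {u v u′ v′} → u ∈p → v ∈p → u′ ∈p → v′ ∈p → u ≢ v → u′ ≢ v′ →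
                          FreePair u v → FreePair u′ v′ → PartialIsoᶠ ⟪ u , v ⟫ ⟪ u′ , v′ ⟫
  free-pairs-partialIso u∈p v∈p u′∈p v′∈p u≢v u′≢v′ free free′ =
    (λ i j → mk⇔ (distinct-pair-≡ u∈p v∈p u≢v i j) (distinct-pair-≡ u′∈p v′∈p u′≢v′ i j)) ,
    (λ r s → mk⇔ (free-pair-rel u∈p v∈p u′∈p v′∈p free r s)
                  (free-pair-rel u′∈p v′∈p u∈p v∈p free′ r s))

  free-pairs-satisfy-alike : Homogeneous V M →
                             ∀ {u v u′ v′} → u ∈p → v ∈p → u′ ∈p → v′ ∈p → u ≢ v → u′ ≢ v′ →
                             FreePair u v → FreePair u′ v′ →
                             (E : Formula V m 2) → RelE V M A E u v → RelE V M A E u′ v′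
  free-pairs-satisfy-alike hom u∈p v∈p u′∈p v′∈p u≢v u′≢v′ free free′ E uEv
    with homogeneous-extension hom (free-pairs-partialIso u∈p v∈p u′∈p v′∈p u≢v u′≢v′ free free′)
  ... | σ , σ-maps =
    subst₂ (λ x y → RelE V M A E x y) (σ-maps zero) (σ-maps (suc zero))
      (Sat-⟦⟧ A σ (λ j → σ-maps (suc (suc j))) E (_ ∷ _ ∷ []) uEv)

  Contains : (Fin k → C) → Set
  Contains w = ∀ j → ∃ λ i → w i ≡ lookup A j

  module _ {k a} {w : Fin k → C} {u : Fin a → C} {z : C} (copy : FreeCopy w u z) (w⊇A : Contains w) where
    open FreeCopy copy

    copy-fixes-params : Fixes τ A
    copy-fixes-params j = subst (λ x → ⟦ τ ⟧ x ≡ x) (proj₂ (w⊇A j)) (τ-fixes (proj₁ (w⊇A j)))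

    copy-realizes : z ∈p → ⟦ τ ⟧ z ∈p
    copy-realizes z∈p φ p∋φ = Sat-⟦⟧ A τ copy-fixes-params φ (z ∷ []) (z∈p φ p∋φ)

    copy-≢ : ∀ i → u i ≢ ⟦ τ ⟧ z
    copy-≢ i eq = copy-fresh (k ↑ʳ i) (trans (lookup-++ʳ w u i) eq)

    copy-free-pair : ∀ i → FreePair (u i) (⟦ τ ⟧ z)
    copy-free-pair i = Unlinked-reindex index index-agrees (copy-unlinked i)
      where
      index : Fin (2 + m) → Fin (k + a + 1)
      index zero          = (k ↑ʳ i) ↑ˡ 1
      index (suc zero)    = (k + a) ↑ʳ zero
      index (suc (suc j)) = (proj₁ (w⊇A j) ↑ˡ a) ↑ˡ 1
      index-agrees : ∀ j → ((w ++ u) ++ replicate 1 (⟦ τ ⟧ z)) (index j) ≡ ⟪ u i , ⟦ τ ⟧ z ⟫ j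
      index-agrees zero          = trans (lookup-++ˡ (w ++ u) _ _) (lookup-++ʳ w u i)
      index-agrees (suc zero)    = lookup-++ʳ (w ++ u) _ zero
      index-agrees (suc (suc j)) =
        trans (lookup-++ˡ (w ++ u) _ _) (trans (lookup-++ˡ w u _) (proj₂ (w⊇A j)))

  module _ (hom : Homogeneous V M) (fap : FreeAmalgamationProperty V M) where
    open InjectiveCover (injectiveCover V M (Countable⇒≡-dec V M (proj₁ hom)) A)

    realization-∉-enum : ∀ {x} → x ∈p → ∀ q → enum q ≢ x
    realization-∉-enum x∈p q eq with enum-in q
    ... | j , aⱼ≡ = realization-∉-params x∈p j (trans (sym eq) (sym aⱼ≡))

    enum⊇A : Contains enum
    enum⊇A j = index j , enum-index j

    linked-free-pair : (E : Formula V m 2) → IsEquivOn V M A p E → ∀ {b c} → b ∈p → c ∈p → b ≢ c →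
                       RelE V M A E b c → ∃ λ e → e ∈p × c ≢ e × FreePair c e × RelE V M A E c e
    linked-free-pair E (_ , E-sym , E-trans) {b} {c} b∈p c∈p b≢c bEc =
      ⟦ τ ⟧ c , e∈p , copy-≢ copy w⊇A zero , copy-free-pair copy w⊇A zero ,
      E-trans c b (⟦ τ ⟧ c) c∈p b∈p e∈p (E-sym b c b∈p c∈p bEc) bEe
      where
      w : Fin (size + 1) → C
      w = enum ++ replicate 1 b
      w-inj : Injective _≡_ _≡_ w
      w-inj = ++-injective enum-inj replicate₁-injective (λ q _ → realization-∉-enum b∈p q)
      wc-inj : Injective _≡_ _≡_ (w ++ replicate 1 c)
      wc-inj = ++-injective w-inj replicate₁-injective
                 (λ i _ → ++-≢ (realization-∉-enum c∈p) (λ _ → b≢c) i)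
      copy = free-extension hom fap w (replicate 1 c) c wc-inj wc-inj
      open FreeCopy copy
      w⊇A : Contains w
      w⊇A j = index j ↑ˡ 1 , trans (lookup-++ˡ enum _ (index j)) (enum-index j)
      e∈p = copy-realizes copy w⊇A c∈p
      τb≡b : ⟦ τ ⟧ b ≡ b
      τb≡b = trans (cong ⟦ τ ⟧ (sym (lookup-++ʳ enum _ zero)))
                   (trans (τ-fixes (size ↑ʳ zero)) (lookup-++ʳ enum _ zero))
      bEe : RelE V M A E b (⟦ τ ⟧ c)
      bEe = subst (λ x → RelE V M A E x (⟦ τ ⟧ c)) τb≡b
              (Sat-⟦⟧ A τ (copy-fixes-params copy w⊇A) E (b ∷ c ∷ []) bEc)

    common-free-copy : ∀ {x y} → x ∈p → y ∈p → x ≢ y →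
                       ∃ λ e → e ∈p × x ≢ e × y ≢ e × FreePair x e × FreePair y e
    common-free-copy {x} {y} x∈p y∈p x≢y =
      ⟦ τ ⟧ x , copy-realizes copy enum⊇A x∈p ,
      copy-≢ copy enum⊇A zero , copy-≢ copy enum⊇A (suc zero) ,
      copy-free-pair copy enum⊇A zero , copy-free-pair copy enum⊇A (suc zero)
      where
      u : Fin 2 → C
      u = lookup (x ∷ y ∷ [])
      u-inj : Injective _≡_ _≡_ u
      u-inj {zero}     {zero}     _  = refl
      u-inj {zero}     {suc zero} eq = contradiction eq x≢y
      u-inj {suc zero} {zero}     eq = contradiction (sym eq) x≢y
      u-inj {suc zero} {suc zero} _  = refl
      u∈p : ∀ i → u i ∈p
      u∈p zero       = x∈p
      u∈p (suc zero) = y∈p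
      copy = free-extension hom fap enum u x
               (++-injective enum-inj u-inj (λ q i → realization-∉-enum (u∈p i) q))
               (++-injective enum-inj replicate₁-injective (λ q _ → realization-∉-enum x∈p q))
      open FreeCopy copy

proposition5p2 : ExcludedMiddle 0ℓ →
    (V : Vocabulary) (M : Structure V) →
    Homogeneous V M →
    FreeAmalgamationProperty V M →
    ∀ (m : ℕ) (A : Vec (Structure.Carrier M) m) (p : Type1 V M m) →
    IsCompleteType V M A p →
    NonAlgebraic V M A p →
    ∀ (E : Formula V m 2) →
    IsEquivOn V M A p E →
    ¬ NontrivialOn V M A p E
proposition5p2 _ V M hom fap m A p p-complete p-nonalgebraic E E-equiv@(E-refl , E-sym , E-trans)
               ((x , y , x∈p , y∈p , ¬xEy) , (b , c , b∈p , c∈p , b≢c , bEc)) =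
  let (e₀ , e₀∈p , c≢e₀ , ce₀-free , cEe₀)         = linked-free-pair hom fap E E-equiv b∈p c∈p b≢c bEc
      (e , e∈p , x≢e , y≢e , xe-free , ye-free) = common-free-copy hom fap x∈p y∈p x≢y
      xEe = free-pairs-satisfy-alike hom c∈p e₀∈p x∈p e∈p c≢e₀ x≢e ce₀-free xe-free E cEe₀
      yEe = free-pairs-satisfy-alike hom c∈p e₀∈p y∈p e∈p c≢e₀ y≢e ce₀-free ye-free E cEe₀
  in ¬xEy (E-trans x e y x∈p e∈p y∈p xEe (E-sym y e y∈p e∈p yEe))
  where
  open Realizations V M A p p-complete p-nonalgebraic
  x≢y : x ≢ y
  x≢y refl = ¬xEy (E-refl x x∈p)
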